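{- Let $k\ge 3$, $X=\{x_1,\dots,x_k\}$ pairwise distinct variables, $\varphi$ an equality-free formula with $\mathrm{V}(\varphi)\subseteq X$, and $z\in\{x_1,x_2,x_3\}$. Then $(\bigwedge\Gamma^{(k)}_{\mathrm{FO3}_=,\varphi})\to\mathrm{T}^{(k)}_z(\varphi)$ is valid iff $\varphi$ is valid, and it is finitely valid iff $\varphi$ is finitely valid.
   Context: $\Sigma$: countably infinite set of binary predicate symbols; $\mathbf{V}$: countably infinite set of variables. Structures: non-empty universe with a binary relation per symbol; finite if the universe is finite. $\mathrm{FO}_{=}$ formulas $\varphi::=a(x,y)\mid x=y\mid\lnot\varphi\mid\varphi\land\psi\mid\exists x,\varphi$, usual semantics; valid (finitely valid): satisfied by every assignment in every (every finite) structure over the symbols involved. $\mathrm{V}(\varphi)$: variables occurring free or bound. Equality-free: no atom $x=y$. $\mathsf{t}$ denotes a true formula. $\Sigma^{(k)}=\Sigma\cup\{U\}\cup\{\pi_i,Q_i,E_{[1,i]},E_{[i,k]}\mid1\le i\le k\}$ (fresh symbols). $\Gamma^{(k)}_{\mathrm{FO3}_=,\varphi}$ is the finite set of sentences below (variables $x,y,z$ pairwise distinct), for $1\le i\le k$ and $a\in\Sigma$ occurring in $\varphi$, with $E_{[1,0]}(x,y)$ and $E_{[k+1,k]}(x,y)$ standing for $\mathsf{t}$: $\forall x\forall y(U(x,y)\leftrightarrow\bigwedge_{j}\pi_j(x,y))$; $\forall x\forall y(E_{[1,i]}(x,y)\leftrightarrow(E_{[1,i-1]}(x,y)\land\exists z(\pi_i(x,z)\land\pi_i(y,z))))$;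 $\forall x\forall y(E_{[i,k]}(x,y)\leftrightarrow(E_{[i+1,k]}(x,y)\land\exists z(\pi_i(x,z)\land\pi_i(y,z))))$; $\forall x\forall y(Q_i(x,y)\leftrightarrow(E_{[1,i-1]}(x,y)\land E_{[i+1,k]}(x,y)))$; $\forall x\forall y(U(x,y)\to x=y)$; $\forall x\forall y\forall z((\pi_i(x,y)\land\pi_i(x,z))\to y=z)$; $\forall x\exists y(\pi_i(x,y)\land U(y,y))$; $\forall x\forall y(U(y,y)\to\exists z(Q_i(x,z)\land\pi_i(z,y)))$; $\forall x\forall y((x=y)\leftrightarrow E_{[1,k]}(x,y))$; $\exists x\,U(x,x)$; $\forall x\forall y(a(x,y)\to(U(x,x)\land U(y,y)))$. For $z\in\{x_1,x_2,x_3\}$ let $z'$ be the least and $z''$ the other element of $\{x_1,x_2,x_3\}\setminus\{z\}$ under $x_1<x_2<x_3$. $\mathrm{T}^{(k)}_z(a(x_i,x_j))=\exists z'\exists z''(\pi_i(z,z')\land a(z',z'')\land\pi_j(z,z''))$; $\mathrm{T}^{(k)}_z(\lnot\psi)=\lnot\mathrm{T}^{(k)}_z(\psi)$; $\mathrm{T}^{(k)}_z(\psi\land\chi)=\mathrm{T}^{(k)}_z(\psi)\land\mathrm{T}^{(k)}_z(\chi)$; $\mathrm{T}^{(k)}_z(\exists x_i,\psi)=\exists z'(Q_i(z,z')\land\mathrm{T}^{(k)}_{z'}(\psi))$. -}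

module Defs where

open import Data.Nat using (ℕ; zero; suc; _≤_; _<?_; _≟_)
open import Data.Fin using (Fin; zero; suc; toℕ; fromℕ; fromℕ<; inject₁)
open import Data.List using (List; []; _∷_; _++_; map; concatMap; foldr)
open import Data.List.Membership.Propositional using (_∈_)
open import Data.Product using (Σ; _×_; _,_; ∃)
open import Data.Unit using (⊤)
open import Data.Empty using (⊥)
open import Relation.Nullary using (¬_; yes; no)
open import Relation.Binary.PropositionalEquality using (_≡_)
open import Function.Bundles using (_↔_)

data Formula (S V : Set) : Set where
  atom : S → V → V → Formula S V
  eq   : V → V → Formula S V
  neg  : Formula S V → Formula S V
  and  : Formula S V → Formula S V → Formula S V
  ex   : V → Formula S V → Formula S V

-- variable renaming (applied to free and bound occurrences alike)
rename : {S V W : Set} → (V → W) → Formula S V → Formula S W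
rename f (atom a x y) = atom a (f x) (f y)
rename f (eq x y)     = eq (f x) (f y)
rename f (neg φ)      = neg (rename f φ)
rename f (and φ ψ)    = and (rename f φ) (rename f ψ)
rename f (ex x φ)     = ex (f x) (rename f φ)

data EqFree {S V : Set} : Formula S V → Set where
  atom : ∀ a x y → EqFree (atom a x y)
  neg  : ∀ {φ} → EqFree φ → EqFree (neg φ)
  and  : ∀ {φ ψ} → EqFree φ → EqFree ψ → EqFree (and φ ψ)
  ex   : ∀ {x φ} → EqFree φ → EqFree (ex x φ)

syms : {S V : Set} → Formula S V → List S
syms (atom a x y) = a ∷ []
syms (eq x y)     = []
syms (neg φ)      = syms φ
syms (and φ ψ)    = syms φ ++ syms ψ
syms (ex x φ)     = syms φ

module _ {S V : Set} where
  or imp iff : Formula S V → Formula S V → Formula S V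
  or φ ψ  = neg (and (neg φ) (neg ψ))
  imp φ ψ = neg (and φ (neg ψ))
  iff φ ψ = and (imp φ ψ) (imp ψ φ)

  all : V → Formula S V → Formula S V
  all x φ = neg (ex x (neg φ))

  -- a true formula t (uses a variable, any will do)
  tru : V → Formula S V
  tru v = eq v v

  bigAnd : V → List (Formula S V) → Formula S V
  bigAnd v []       = tru v
  bigAnd v (φ ∷ φs) = and φ (bigAnd v φs)

record Structure (S : Set) : Set₁ where
  field
    Carrier : Set
    elem    : Carrier                      -- non-empty universe
    rel     : S → Carrier → Carrier → Set
open Structure public

update : {D : Set} → (ℕ → D) → ℕ → D → ℕ → D
update ρ x d y with x ≟ y
... | yes _ = d
... | no  _ = ρ y

Sat : {S : Set} (M : Structure S) → (ℕ → Carrier M) → Formula S ℕ → Set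
Sat M ρ (atom a x y) = rel M a (ρ x) (ρ y)
Sat M ρ (eq x y)     = ρ x ≡ ρ y
Sat M ρ (neg φ)      = ¬ Sat M ρ φ
Sat M ρ (and φ ψ)    = Sat M ρ φ × Sat M ρ ψ
Sat M ρ (ex x φ)     = ¬ ¬ (Σ (Carrier M) λ d → Sat M (update ρ x d) φ)

FiniteStructure : {S : Set} → Structure S → Set
FiniteStructure M = ∃ λ n → Carrier M ↔ Fin n

Valid : {S : Set} → Formula S ℕ → Set₁
Valid {S} φ = (M : Structure S) (ρ : ℕ → Carrier M) → Sat M ρ φ

FinitelyValid : {S : Set} → Formula S ℕ → Set₁
FinitelyValid {S} φ =
  (M : Structure S) → FiniteStructure M → (ρ : ℕ → Carrier M) → Sat M ρ φ

-- The extended signature Σ^(k)   (index i : Fin k stands for i+1)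

data Sym (k : ℕ) : Set where
  base : ℕ → Sym k         -- original symbols of Σ
  U    : Sym k
  π    : Fin k → Sym k
  Q    : Fin k → Sym k
  E1   : Fin k → Sym k     -- E1 i  = E_[1,i+1]
  Ek   : Fin k → Sym k     -- Ek i  = E_[i+1,k]

-- E_[1,k](u,v)  (k = 0 never arises since k ≥ 3; then t)
E1full : (k : ℕ) → Formula (Sym k) ℕ → ℕ → ℕ → Formula (Sym k) ℕ
E1full zero    t u v = t
E1full (suc k) t u v = atom (E1 (fromℕ k)) u v

module Gamma (k : ℕ) (vx vy vz : ℕ) where
  F = Formula (Sym k) ℕ

  t : F
  t = tru vx

  -- E_[1,i-1](u,v)  (t when i = 1)
  E1prev : Fin k → ℕ → ℕ → F
  E1prev zero    u v = t
  E1prev (suc j) u v = atom (E1 (inject₁ j)) u v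

  -- E_[i+1,k](u,v)  (t when i = k)
  EkNext : Fin k → ℕ → ℕ → F
  EkNext i u v with suc (toℕ i) <? k
  ... | yes p = atom (Ek (fromℕ< p)) u v
  ... | no  _ = t

  E1k : ℕ → ℕ → F
  E1k = E1full k t

  allFin : (n : ℕ) → List (Fin n)
  allFin zero    = []
  allFin (suc n) = zero ∷ map suc (allFin n)

  commonπ : Fin k → F
  commonπ i = ex vz (and (atom (π i) vx vz) (atom (π i) vy vz))

  perI : Fin k → List F
  perI i =
      all vx (all vy (iff (atom (E1 i) vx vy) (and (E1prev i vx vy) (commonπ i))))
    ∷ all vx (all vy (iff (atom (Ek i) vx vy) (and (EkNext i vx vy) (commonπ i))))
    ∷ all vx (all vy (iff (atom (Q i) vx vy) (and (E1prev i vx vy) (EkNext i vx vy))))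
    ∷ all vx (all vy (all vz (imp (and (atom (π i) vx vy) (atom (π i) vx vz)) (eq vy vz))))
    ∷ all vx (ex vy (and (atom (π i) vx vy) (atom U vy vy)))
    ∷ all vx (all vy (imp (atom U vy vy) (ex vz (and (atom (Q i) vx vz) (atom (π i) vz vy)))))
    ∷ []

  perA : ℕ → F
  perA a = all vx (all vy (imp (atom (base a) vx vy) (and (atom U vx vx) (atom U vy vy))))

  Γ : {V : Set} → Formula ℕ V → List F
  Γ φ =
      all vx (all vy (iff (atom U vx vy) (bigAnd vx (map (λ j → atom (π j) vx vy) (allFin k)))))
    ∷ all vx (all vy (imp (atom U vx vy) (eq vx vy)))
    ∷ all vx (all vy (iff (eq vx vy) (E1k vx vy)))
    ∷ ex vx (atom U vx vx)
    ∷ (concatMap perI (allFin k) ++ map perA (syms φ))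

-- The translation T^(k)_z.  w j is the variable x_{j+1} (j : Fin 3);
-- z is given by its index in {x1,x2,x3}.

-- the two other indices, least first
z′ z″ : Fin 3 → Fin 3
z′ zero          = suc zero
z′ (suc zero)    = zero
z′ (suc (suc _)) = zero
z″ zero          = suc (suc zero)
z″ (suc zero)    = suc (suc zero)
z″ (suc (suc _)) = suc zero

-- (on equality atoms, irrelevant for equality-free φ, we return t)
T : (k : ℕ) → (Fin 3 → ℕ) → Fin 3 → Formula ℕ (Fin k) → Formula (Sym k) ℕ
T k w z (atom a i j) =
  ex (w (z′ z)) (ex (w (z″ z))
    (and (atom (π i) (w z) (w (z′ z)))
    (and (atom (base a) (w (z′ z)) (w (z″ z)))
         (atom (π j) (w z) (w (z″ z))))))
T k w z (eq _ _)  = tru (w z)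
T k w z (neg φ)   = neg (T k w z φ)
T k w z (and φ ψ) = and (T k w z φ) (T k w z ψ)
T k w z (ex i φ)  = ex (w (z′ z)) (and (atom (Q i) (w z) (w (z′ z))) (T k w (z′ z) φ))

{-# OPTIONS --safe #-}
-- Any structure M yields a model of Γ: its k-th power Mᵏ, whose points are tuples, π_i picking the
-- i-th coordinate as a point of the diagonal U ≅ M, and Q_i relating tuples that differ at most at
-- coordinate i. A tuple encodes an assignment of x₁ … x_k, and T_z(φ) at that tuple says exactly φ.
-- Conversely, in any model N of Γ the U-points carry a structure for φ, each point v encodes the
-- assignment x_i ↦ π_i(v), and the axioms on E and Q make the Q_i-neighbours of v exactly the points
-- encoding the x_i-variants of that assignment; so T_z(φ) again says φ. Both constructions preserve
-- finiteness. Satisfaction is classical (¬¬), and equality-free formulas are ¬¬-stable except for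
-- those already refuted by a one-point structure, so the argument can be run in the ¬¬ monad.
module Submission where

open import Defs
open import Level using (0ℓ)
open import Data.Nat using (ℕ; zero; suc; _≤_; _<_; _+_; _∸_; _^_; z≤n; s≤s; _<?_; _≟_)
open import Data.Nat.Properties
  using ( ≤-refl; <⇒≤; <⇒≢; ≤-pred; m≤n⇒m≤1+n; m≤n⇒m<n∨m≡n; ≤-<-trans; <-cmp
        ; suc-injective; +-suc; m∸n+n≡m)
open import Data.Fin using (Fin; zero; suc; toℕ; fromℕ; fromℕ<; inject₁; inject≤) renaming (_≟_ to _≟ᶠ_)
open import Data.Fin.Properties
  using ( toℕ-injective; toℕ<n; toℕ≤pred[n]; toℕ-fromℕ; toℕ-fromℕ<; toℕ-inject₁
        ; inject≤-injective; *↔×; any?)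
open import Data.Vec using (Vec; []; _∷_; lookup; replicate; tabulate; _[_]≔_)
open import Data.Vec.Properties
  using (lookup-replicate; lookup∘update; lookup∘update′; lookup∘tabulate; tabulate∘lookup; tabulate-cong)
open import Data.List using (List; []; _∷_; map; concatMap)
open import Data.List.Relation.Unary.All using (All; []; _∷_; universal)
import Data.List.Relation.Unary.All.Properties as All
open import Data.Product using (Σ; Σ-syntax; _×_; _,_; proj₁; proj₂)
open import Data.Product.Function.NonDependent.Propositional using (_×-↔_)
open import Data.Sum using (_⊎_; inj₁; inj₂)
open import Data.Empty using (⊥; ⊥-elim)
open import Data.Unit using (⊤; tt)
open import Effect.Monad using (RawMonad)
open import Relation.Binary using (Tri; tri<; tri≈; tri>)
open import Relation.Nullary using (¬_; Dec; yes; no)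
open import Relation.Nullary.Negation using (¬¬-Monad; ¬¬-map; negated-stable; Stable)
open import Relation.Nullary.Decidable.Core using (¬¬-excluded-middle)
open import Relation.Binary.PropositionalEquality
  using (_≡_; _≢_; ≢-sym; refl; sym; trans; subst; subst₂; cong)
open import Function.Base using (_∘_)
open import Function.Bundles using (_⇔_; _↔_; mk⇔; mk↔ₛ′; Inverse)
open import Function.Construct.Composition using (_↔-∘_)
open import Function.Construct.Symmetry using (↔-sym)
open import Function.Definitions using (Injective)

open RawMonad (¬¬-Monad {0ℓ}) using (pure; _>>=_)

¬¬-Π-Fin : ∀ m {B : Fin m → Set} → (∀ i → ¬ ¬ B i) → ¬ ¬ (∀ i → B i)
¬¬-Π-Fin zero    _ = pure λ ()
¬¬-Π-Fin (suc m) f = do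
  b₀ ← f zero
  bs ← ¬¬-Π-Fin m (f ∘ suc)
  pure λ { zero → b₀ ; (suc i) → bs i }

¬¬-Dec-Fin : ∀ m {B : Fin m → Set} → ¬ ¬ (∀ i → Dec (B i))
¬¬-Dec-Fin m = ¬¬-Π-Fin m (λ _ → ¬¬-excluded-middle)

module _ {D : Set} where

  update-≡ : (ρ : ℕ → D) (x : ℕ) (d : D) → update ρ x d x ≡ d
  update-≡ ρ x d with x ≟ x
  ... | yes _  = refl
  ... | no x≢x = ⊥-elim (x≢x refl)

  update-≢ : (ρ : ℕ → D) {x y : ℕ} (d : D) → x ≢ y → update ρ x d y ≡ ρ y
  update-≢ ρ {x} {y} d x≢y with x ≟ y
  ... | yes x≡y = ⊥-elim (x≢y x≡y)
  ... | no _    = refl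

module _ {C : Set} {P : C → Set} where

  all-intro : (∀ d → ¬ ¬ P d) → ¬ ¬ ¬ Σ C (¬_ ∘ P)
  all-intro f ¬¬∃¬ = ¬¬∃¬ λ (d , ¬p) → f d ¬p

  all-elim : ¬ ¬ ¬ Σ C (¬_ ∘ P) → ∀ d → ¬ ¬ P d
  all-elim ¬∃¬ d ¬p = ¬∃¬ λ k → k (d , ¬p)

module _ {A B : Set} where

  imp-intro : (A → ¬ ¬ B) → ¬ (A × ¬ B)
  imp-intro f (a , ¬b) = f a ¬b

  imp-elim : ¬ (A × ¬ B) → A → ¬ ¬ B
  imp-elim ¬a×¬b a ¬b = ¬a×¬b (a , ¬b)

module _ {S : Set} (M : Structure S) {ρ : ℕ → Carrier M} where

  sat-bigAnd⁺ : ∀ v (φs : List (Formula S ℕ)) → All (Sat M ρ) φs → Sat M ρ (bigAnd v φs)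
  sat-bigAnd⁺ v []       []       = refl
  sat-bigAnd⁺ v (φ ∷ φs) (s ∷ ss) = s , sat-bigAnd⁺ v φs ss

  sat-bigAnd⁻ : ∀ v (φs : List (Formula S ℕ)) → Sat M ρ (bigAnd v φs) → All (Sat M ρ) φs
  sat-bigAnd⁻ v []       _        = []
  sat-bigAnd⁻ v (φ ∷ φs) (s , ss) = s ∷ sat-bigAnd⁻ v φs ss

trivial : (S : Set) → Structure S
trivial S = record { Carrier = ⊤ ; elem = tt ; rel = λ _ _ _ → ⊥ }

trivial-finite : ∀ {S} → FiniteStructure (trivial S)
trivial-finite = 1 , mk↔ₛ′ (λ _ → zero) (λ _ → tt) (λ { zero → refl }) (λ _ → refl)

-- Only atoms are not ¬¬-stable, and an atom fails in the trivial structure.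
stable-or-refuted : ∀ {S} {φ : Formula S ℕ} → EqFree φ →
  (∀ M ρ → Stable (Sat M ρ φ)) ⊎ (∀ ρ → ¬ Sat (trivial S) ρ φ)
stable-or-refuted (atom a x y) = inj₂ λ _ ()
stable-or-refuted (neg _)      = inj₁ λ _ _ → negated-stable
stable-or-refuted (ex _)       = inj₁ λ _ _ → negated-stable
stable-or-refuted (and ef₁ ef₂) with stable-or-refuted ef₁ | stable-or-refuted ef₂
... | inj₂ ¬φ      | _         = inj₂ λ ρ s → ¬φ ρ (proj₁ s)
... | inj₁ _       | inj₂ ¬ψ   = inj₂ λ ρ s → ¬ψ ρ (proj₂ s)
... | inj₁ stable₁ | inj₁ stable₂ =
  inj₁ λ M ρ s → stable₁ M ρ (¬¬-map proj₁ s) , stable₂ M ρ (¬¬-map proj₂ s)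

valid-from-¬¬ : ∀ {S} {φ : Formula S ℕ} → EqFree φ → (P : Structure S → Set) → P (trivial S) →
  (∀ M → P M → ∀ ρ → ¬ ¬ Sat M ρ φ) → ∀ M → P M → ∀ ρ → Sat M ρ φ
valid-from-¬¬ ef P P-trivial ¬¬sat M PM ρ with stable-or-refuted ef
... | inj₁ stable = stable M ρ (¬¬sat M PM ρ)
... | inj₂ ¬φ     = ⊥-elim (¬¬sat _ P-trivial _ (¬φ _))

rename-EqFree : ∀ {S V W} (f : V → W) {φ : Formula S V} → EqFree φ → EqFree (rename f φ)
rename-EqFree f (atom a x y) = atom a (f x) (f y)
rename-EqFree f (neg e)      = neg (rename-EqFree f e)
rename-EqFree f (and e₁ e₂)  = and (rename-EqFree f e₁) (rename-EqFree f e₂)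
rename-EqFree f (ex e)       = ex (rename-EqFree f e)

module _ {C : Set} {m : ℕ} (xs : Fin m → ℕ) where

  extend : (Fin m → C) → C → ℕ → C
  extend f c₀ x with any? (λ i → xs i ≟ x)
  ... | yes (i , _) = f i
  ... | no _        = c₀

  extend-xs : Injective _≡_ _≡_ xs → ∀ f c₀ i → extend f c₀ (xs i) ≡ f i
  extend-xs xs-inj f c₀ i with any? (λ j → xs j ≟ xs i)
  ... | yes (j , xⱼ≡xᵢ) = cong f (xs-inj xⱼ≡xᵢ)
  ... | no ∄            = ⊥-elim (∄ (i , refl))

¬¬-Dec-finite : ∀ {A : Set} {m} → A ↔ Fin m → {P : A → Set} → ¬ ¬ (∀ a → Dec (P a))
¬¬-Dec-finite {m = m} iso {P} = do
  dec ← ¬¬-Dec-Fin m {P ∘ from}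
  pure λ a → subst (Dec ∘ P) (strictlyInverseʳ a) (dec (to a))
  where open Inverse iso

module _ {A : Set} {P : A → Set} (P? : ∀ a → Dec (P a)) (a₀ : A) (Pa₀ : P a₀) where

  retract : A → A
  retract a with P? a
  ... | yes _ = a
  ... | no _  = a₀

  retract-∈ : ∀ a → P (retract a)
  retract-∈ a with P? a
  ... | yes Pa = Pa
  ... | no _   = Pa₀

  retract-id : ∀ {a} → P a → retract a ≡ a
  retract-id {a} Pa with P? a
  ... | yes _  = refl
  ... | no ¬Pa = ⊥-elim (¬Pa Pa)

Vec↔Fin^ : ∀ {D : Set} {m} → D ↔ Fin m → ∀ k → Vec D k ↔ Fin (m ^ k)
Vec↔Fin^ iso zero = mk↔ₛ′ (λ _ → zero) (λ _ → []) (λ { zero → refl }) (λ { [] → refl })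
Vec↔Fin^ {m = m} iso (suc k) = ↔-sym (*↔× {m} {m ^ k}) ↔-∘ ((iso ×-↔ Vec↔Fin^ iso k) ↔-∘ head×tail)
  where
  head×tail : Vec _ (suc k) ↔ (_ × Vec _ k)
  head×tail = mk↔ₛ′ (λ { (x ∷ xs) → x , xs }) (λ (x , xs) → x ∷ xs) (λ _ → refl) (λ { (_ ∷ _) → refl })

module IndexRelations {K : ℕ} (N : Structure (Sym K)) where

  private
    B = Carrier N
    R = rel N

  E1prevᴿ : Fin K → B → B → Set
  E1prevᴿ zero    _ _ = ⊤
  E1prevᴿ (suc j) d e = R (E1 (inject₁ j)) d e

  EkNextᴿ : Fin K → B → B → Set
  EkNextᴿ i d e = (p : suc (toℕ i) < K) → R (Ek (fromℕ< p)) d e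

  Commonπᴿ : Fin K → B → B → Set
  Commonπᴿ i d e = Σ[ y ∈ B ] R (π i) d y × R (π i) e y

module GammaSemantics {K : ℕ} (N : Structure (Sym K)) (vx vy vz : ℕ)
  (x≢y : vx ≢ vy) (x≢z : vx ≢ vz) (y≢z : vy ≢ vz) where

  open Gamma K vx vy vz
  open IndexRelations N public
  private
    B = Carrier N
    R = rel N

  upd₂ : (ℕ → B) → B → B → ℕ → B
  upd₂ σ d e = update (update σ vx d) vy e

  upd₃ : (ℕ → B) → B → B → B → ℕ → B
  upd₃ σ d e f = update (upd₂ σ d e) vz f

  upd₂-x : ∀ {σ} d e → upd₂ σ d e vx ≡ d
  upd₂-x {σ} d e = trans (update-≢ _ e (≢-sym x≢y)) (update-≡ σ vx d)

  upd₂-y : ∀ {σ} d e → upd₂ σ d e vy ≡ e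
  upd₂-y {σ} d e = update-≡ _ vy e

  upd₃-x : ∀ {σ} d e f → upd₃ σ d e f vx ≡ d
  upd₃-x {σ} d e f = trans (update-≢ _ f (≢-sym x≢z)) (upd₂-x {σ} d e)

  upd₃-y : ∀ {σ} d e f → upd₃ σ d e f vy ≡ e
  upd₃-y {σ} d e f = trans (update-≢ _ f (≢-sym y≢z)) (upd₂-y {σ} d e)

  upd₃-z : ∀ {σ} d e f → upd₃ σ d e f vz ≡ f
  upd₃-z {σ} d e f = update-≡ _ vz f

  atom-xy⁺ : ∀ s {σ d e} → R s d e → Sat N (upd₂ σ d e) (atom s vx vy)
  atom-xy⁺ s {d = d} {e} = subst₂ (R s) (sym (upd₂-x d e)) (sym (upd₂-y d e))

  atom-xy⁻ : ∀ s {σ d e} → Sat N (upd₂ σ d e) (atom s vx vy) → R s d e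
  atom-xy⁻ s {d = d} {e} = subst₂ (R s) (upd₂-x d e) (upd₂-y d e)

  All-allFin⁺ : ∀ m {P : Fin m → Set} → (∀ j → P j) → All P (allFin m)
  All-allFin⁺ zero    _ = []
  All-allFin⁺ (suc m) f = f zero ∷ All.map⁺ (All-allFin⁺ m (f ∘ suc))

  All-allFin⁻ : ∀ m {P : Fin m → Set} → All P (allFin m) → ∀ j → P j
  All-allFin⁻ (suc m) (p ∷ _)  zero    = p
  All-allFin⁻ (suc m) (_ ∷ ps) (suc j) = All-allFin⁻ m (All.map⁻ ps) j

  module _ {σ : ℕ → B} {d e : B} where

    sat-E1prev⁺ : ∀ i → E1prevᴿ i d e → Sat N (upd₂ σ d e) (E1prev i vx vy)
    sat-E1prev⁺ zero    _ = refl
    sat-E1prev⁺ (suc j) r = atom-xy⁺ (E1 (inject₁ j)) r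

    sat-E1prev⁻ : ∀ i → Sat N (upd₂ σ d e) (E1prev i vx vy) → E1prevᴿ i d e
    sat-E1prev⁻ zero    _ = tt
    sat-E1prev⁻ (suc j) s = atom-xy⁻ (E1 (inject₁ j)) s

    sat-EkNext⁺ : ∀ i → EkNextᴿ i d e → Sat N (upd₂ σ d e) (EkNext i vx vy)
    sat-EkNext⁺ i r with suc (toℕ i) <? K
    ... | yes p = atom-xy⁺ (Ek (fromℕ< p)) (r p)
    ... | no _  = refl

    sat-EkNext⁻ : ∀ i → Sat N (upd₂ σ d e) (EkNext i vx vy) → EkNextᴿ i d e
    sat-EkNext⁻ i s with suc (toℕ i) <? K
    ... | yes p = λ _ → atom-xy⁻ (Ek (fromℕ< p)) s
    ... | no ¬p = λ p → ⊥-elim (¬p p)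

    sat-commonπ⁺ : ∀ i → Commonπᴿ i d e → Sat N (upd₂ σ d e) (commonπ i)
    sat-commonπ⁺ i (f , p , q) = pure
      ( f
      , subst₂ (R (π i)) (sym (upd₃-x d e f)) (sym (upd₃-z d e f)) p
      , subst₂ (R (π i)) (sym (upd₃-y d e f)) (sym (upd₃-z d e f)) q)

    sat-commonπ⁻ : ∀ i → Sat N (upd₂ σ d e) (commonπ i) → ¬ ¬ Commonπᴿ i d e
    sat-commonπ⁻ i s = do
      (f , p , q) ← s
      pure ( f
           , subst₂ (R (π i)) (upd₃-x d e f) (upd₃-z d e f) p
           , subst₂ (R (π i)) (upd₃-y d e f) (upd₃-z d e f) q)

z≢z′ : ∀ z → z ≢ z′ z
z≢z′ zero ()
z≢z′ (suc zero) ()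
z≢z′ (suc (suc zero)) ()

z≢z″ : ∀ z → z ≢ z″ z
z≢z″ zero ()
z≢z″ (suc zero) ()
z≢z″ (suc (suc zero)) ()

z′≢z″ : ∀ z → z′ z ≢ z″ z
z′≢z″ zero ()
z′≢z″ (suc zero) ()
z′≢z″ (suc (suc zero)) ()

_⇔¬¬_ : Set → Set → Set
A ⇔¬¬ B = (A → ¬ ¬ B) × (B → ¬ ¬ A)

module Translation {k : ℕ} (N : Structure (Sym k)) (M : Structure ℕ) (xs : Fin k → ℕ)
  (w : Fin 3 → ℕ) (w-inj : Injective _≡_ _≡_ w)
  (Sim : Carrier N → (ℕ → Carrier M) → Set)
  (atom-forth : ∀ v ρ a i j e′ e″ → Sim v ρ →
     rel N (π i) v e′ → rel N (base a) e′ e″ → rel N (π j) v e″ → ¬ ¬ rel M a (ρ (xs i)) (ρ (xs j)))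
  (atom-back : ∀ v ρ a i j → Sim v ρ → rel M a (ρ (xs i)) (ρ (xs j)) →
     ¬ ¬ (Σ[ e′ ∈ Carrier N ] Σ[ e″ ∈ Carrier N ] rel N (π i) v e′ × rel N (base a) e′ e″ × rel N (π j) v e″))
  (ex-forth : ∀ v ρ i e → Sim v ρ → rel N (Q i) v e → ¬ ¬ (Σ[ c ∈ Carrier M ] Sim e (update ρ (xs i) c)))
  (ex-back : ∀ v ρ i → Sim v ρ → (c : Carrier M) →
     ¬ ¬ (Σ[ e ∈ Carrier N ] rel N (Q i) v e × Sim e (update ρ (xs i) c)))
  where

  private
    B = Carrier N

    w≢w : ∀ {a b} → a ≢ b → w a ≢ w b
    w≢w a≢b = a≢b ∘ w-inj

  sat-T : ∀ {φ} → EqFree φ → ∀ z {σ ρ} → Sim (σ (w z)) ρ → Sat N σ (T k w z φ) ⇔¬¬ Sat M ρ (rename xs φ)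
  sat-T (atom a i j) z {σ} {ρ} sim = forth , back
    where
    σ″ : B → B → ℕ → B
    σ″ e′ e″ = update (update σ (w (z′ z)) e′) (w (z″ z)) e″

    at-z : ∀ e′ e″ → σ″ e′ e″ (w z) ≡ σ (w z)
    at-z e′ e″ = trans (update-≢ _ e″ (w≢w (≢-sym (z≢z″ z)))) (update-≢ σ e′ (w≢w (≢-sym (z≢z′ z))))

    at-z′ : ∀ e′ e″ → σ″ e′ e″ (w (z′ z)) ≡ e′
    at-z′ e′ e″ = trans (update-≢ _ e″ (w≢w (≢-sym (z′≢z″ z)))) (update-≡ σ (w (z′ z)) e′)

    at-z″ : ∀ e′ e″ → σ″ e′ e″ (w (z″ z)) ≡ e″
    at-z″ e′ e″ = update-≡ _ (w (z″ z)) e″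

    forth : Sat N σ (T k w z (atom a i j)) → ¬ ¬ rel M a (ρ (xs i)) (ρ (xs j))
    forth s = do
      (e′ , s′) ← s
      (e″ , p , r , q) ← s′
      atom-forth _ ρ a i j e′ e″ sim (subst₂ (rel N (π i)) (at-z e′ e″) (at-z′ e′ e″) p)
                     (subst₂ (rel N (base a)) (at-z′ e′ e″) (at-z″ e′ e″) r)
                     (subst₂ (rel N (π j)) (at-z e′ e″) (at-z″ e′ e″) q)

    back : rel M a (ρ (xs i)) (ρ (xs j)) → ¬ ¬ Sat N σ (T k w z (atom a i j))
    back r = do
      (e′ , e″ , p , r′ , q) ← atom-back _ ρ a i j sim r
      pure (pure (e′ , pure (e″
        , subst₂ (rel N (π i)) (sym (at-z e′ e″)) (sym (at-z′ e′ e″)) p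
        , subst₂ (rel N (base a)) (sym (at-z′ e′ e″)) (sym (at-z″ e′ e″)) r′
        , subst₂ (rel N (π j)) (sym (at-z e′ e″)) (sym (at-z″ e′ e″)) q)))
  sat-T (neg ef) z sim =
      (λ s → pure λ r → proj₂ (sat-T ef z sim) r s)
    , (λ s → pure λ t → proj₁ (sat-T ef z sim) t s)
  sat-T (and ef₁ ef₂) z sim =
      (λ (s , t) → do a ← proj₁ (sat-T ef₁ z sim) s ; b ← proj₁ (sat-T ef₂ z sim) t ; pure (a , b))
    , (λ (s , t) → do a ← proj₂ (sat-T ef₁ z sim) s ; b ← proj₂ (sat-T ef₂ z sim) t ; pure (a , b))
  sat-T {ex i ψ} (ex ef) z {σ} {ρ} sim = forth , back
    where
    at-z : ∀ e → update σ (w (z′ z)) e (w z) ≡ σ (w z)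
    at-z e = update-≢ σ e (w≢w (≢-sym (z≢z′ z)))

    at-z′ : ∀ e → update σ (w (z′ z)) e (w (z′ z)) ≡ e
    at-z′ e = update-≡ σ (w (z′ z)) e

    Sim-at-z′ : ∀ e c → Sim e (update ρ (xs i) c) → Sim (update σ (w (z′ z)) e (w (z′ z))) (update ρ (xs i) c)
    Sim-at-z′ e c = subst (λ v → Sim v _) (sym (at-z′ e))

    forth : Sat N σ (T k w z (ex i ψ)) → ¬ ¬ Sat M ρ (rename xs (ex i ψ))
    forth s = do
      (e , q , t) ← s
      (c , sim′) ← ex-forth _ ρ i e sim (subst₂ (rel N (Q i)) (at-z e) (at-z′ e) q)
      pure (¬¬-map (c ,_) (proj₁ (sat-T ef (z′ z) (Sim-at-z′ e c sim′)) t))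

    back : Sat M ρ (rename xs (ex i ψ)) → ¬ ¬ Sat N σ (T k w z (ex i ψ))
    back s = do
      (c , r) ← s
      (e , q , sim′) ← ex-back _ ρ i sim c
      pure (¬¬-map (λ t → e , subst₂ (rel N (Q i)) (sym (at-z e)) (sym (at-z′ e)) q , t)
                   (proj₂ (sat-T ef (z′ z) (Sim-at-z′ e c sim′)) r))

module Power (M : Structure ℕ) (n : ℕ) where

  private
    K = suc n
    D = Carrier M
    V = Vec D K

  const : D → V
  const = replicate K

  Agree : Fin K → V → V → Set
  Agree j x y = lookup x j ≡ lookup y j

  Uᴾ : V → V → Set
  Uᴾ x y = ∀ j → y ≡ const (lookup x j)

  relᴾ : Sym K → V → V → Set
  relᴾ (base a) x y = Uᴾ x x × Uᴾ y y × rel M a (lookup x zero) (lookup y zero)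
  relᴾ U        x y = Uᴾ x y
  relᴾ (π i)    x y = y ≡ const (lookup x i)
  relᴾ (Q i)    x y = ∀ j → j ≢ i → Agree j x y
  relᴾ (E1 i)   x y = ∀ j → toℕ j ≤ toℕ i → Agree j x y
  relᴾ (Ek i)   x y = ∀ j → toℕ i ≤ toℕ j → Agree j x y

  Mᵏ : Structure (Sym K)
  Mᵏ = record { Carrier = V ; elem = const (elem M) ; rel = relᴾ }

  open IndexRelations Mᵏ

  vec-ext : ∀ {m} (x y : Vec D m) → (∀ j → lookup x j ≡ lookup y j) → x ≡ y
  vec-ext x y x≗y = trans (sym (tabulate∘lookup x)) (trans (tabulate-cong x≗y) (tabulate∘lookup y))

  const-injective : ∀ {a b} → const a ≡ const b → a ≡ b
  const-injective = cong (λ v → lookup v zero)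

  Uᴾ-const : ∀ a → Uᴾ (const a) (const a)
  Uᴾ-const a j = cong const (sym (lookup-replicate j a))

  Uᴾ⇒≡ : ∀ {x y} → Uᴾ x y → x ≡ y
  Uᴾ⇒≡ {x} {y} u = vec-ext x y λ j → sym (trans (cong (λ v → lookup v j) (u j)) (lookup-replicate j (lookup x j)))

  Agree⇒Commonπ : ∀ i x y → Agree i x y → Commonπᴿ i x y
  Agree⇒Commonπ i x y x≈y = const (lookup x i) , refl , cong const x≈y

  Commonπ⇒Agree : ∀ i x y → Commonπᴿ i x y → Agree i x y
  Commonπ⇒Agree i x y (_ , p , q) = const-injective (trans (sym p) q)

  E1-unfold : ∀ i x y → relᴾ (E1 i) x y → E1prevᴿ i x y × Agree i x y
  E1-unfold zero    x y r = tt , r zero z≤n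
  E1-unfold (suc i) x y r =
    (λ j j≤i → r j (m≤n⇒m≤1+n (subst (toℕ j ≤_) (toℕ-inject₁ i) j≤i))) , r (suc i) ≤-refl

  E1-fold : ∀ i x y → E1prevᴿ i x y → Agree i x y → relᴾ (E1 i) x y
  E1-fold zero    x y _    x≈y zero    _ = x≈y
  E1-fold (suc i) x y prev x≈y j j≤i with m≤n⇒m<n∨m≡n j≤i
  ... | inj₁ j<i = prev j (subst (toℕ j ≤_) (sym (toℕ-inject₁ i)) (≤-pred j<i))
  ... | inj₂ j≡i = subst (λ j → Agree j x y) (sym (toℕ-injective j≡i)) x≈y

  Ek-unfold : ∀ i x y → relᴾ (Ek i) x y → EkNextᴿ i x y × Agree i x y
  Ek-unfold i x y r = (λ p j i<j → r j (<⇒≤ (subst (_≤ toℕ j) (toℕ-fromℕ< p) i<j))) , r i ≤-refl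

  Ek-fold : ∀ i x y → EkNextᴿ i x y → Agree i x y → relᴾ (Ek i) x y
  Ek-fold i x y next x≈y j i≤j with m≤n⇒m<n∨m≡n i≤j
  ... | inj₁ i<j = next p j (subst (_≤ toℕ j) (sym (toℕ-fromℕ< p)) i<j)
    where p = ≤-<-trans i<j (toℕ<n j)
  ... | inj₂ i≡j = subst (λ j → Agree j x y) (toℕ-injective i≡j) x≈y

  Q-unfold : ∀ i x y → relᴾ (Q i) x y → E1prevᴿ i x y × EkNextᴿ i x y
  Q-unfold i x y q = prev i q , λ p j i<j → q j λ { refl → <⇒≢ (subst (_≤ toℕ j) (toℕ-fromℕ< p) i<j) refl }
    where
    prev : ∀ i → relᴾ (Q i) x y → E1prevᴿ i x y
    prev zero    _ = tt
    prev (suc i) q j j≤i = q j λ { refl → <⇒≢ (s≤s (subst (toℕ j ≤_) (toℕ-inject₁ i) j≤i)) refl }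

  Q-fold : ∀ i x y → E1prevᴿ i x y → EkNextᴿ i x y → relᴾ (Q i) x y
  Q-fold i x y prev next j j≢i with <-cmp (toℕ j) (toℕ i)
  Q-fold (suc i) x y prev next j j≢i | tri< j<i _ _ = prev j (subst (toℕ j ≤_) (sym (toℕ-inject₁ i)) (≤-pred j<i))
  ... | tri≈ _ j≡i _ = ⊥-elim (j≢i (toℕ-injective j≡i))
  ... | tri> _ _ i<j = next p j (subst (_≤ toℕ j) (sym (toℕ-fromℕ< p)) i<j)
    where p = ≤-<-trans i<j (toℕ<n j)

  module _ (vx vy vz : ℕ) (x≢y : vx ≢ vy) (x≢z : vx ≢ vz) (y≢z : vy ≢ vz) where

    open Gamma K vx vy vz
    open GammaSemantics Mᵏ vx vy vz x≢y x≢z y≢z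

    module _ (σ : ℕ → V) where

      U-def : Sat Mᵏ σ (all vx (all vy (iff (atom U vx vy) (bigAnd vx (map (λ j → atom (π j) vx vy) (allFin K))))))
      U-def = all-intro λ d → pure (all-intro λ e → pure
        ( imp-intro (λ u → pure (sat-bigAnd⁺ Mᵏ vx _ (All.map⁺ (All-allFin⁺ K λ j →
            atom-xy⁺ (π j) (atom-xy⁻ U u j)))))
        , imp-intro (λ πs → pure (atom-xy⁺ U λ j →
            atom-xy⁻ (π j) (All-allFin⁻ K (All.map⁻ (sat-bigAnd⁻ Mᵏ vx _ πs)) j)))))

      U⇒eq : Sat Mᵏ σ (all vx (all vy (imp (atom U vx vy) (eq vx vy))))
      U⇒eq = all-intro λ d → pure (all-intro λ e → pure (imp-intro λ u →
        pure (trans (upd₂-x d e) (trans (Uᴾ⇒≡ (atom-xy⁻ U u)) (sym (upd₂-y d e))))))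

      eq⇔E1k : Sat Mᵏ σ (all vx (all vy (iff (eq vx vy) (E1k vx vy))))
      eq⇔E1k = all-intro λ d → pure (all-intro λ e → pure
        ( imp-intro (λ q → pure (atom-xy⁺ (E1 (fromℕ n)) λ j _ →
            cong (λ v → lookup v j) (trans (sym (upd₂-x d e)) (trans q (upd₂-y d e)))))
        , imp-intro (λ r → pure (trans (upd₂-x d e) (trans (vec-ext d e λ j →
            atom-xy⁻ (E1 (fromℕ n)) r j (subst (toℕ j ≤_) (sym (toℕ-fromℕ n)) (toℕ≤pred[n] j)))
            (sym (upd₂-y d e)))))))

      U-inhabited : Sat Mᵏ σ (ex vx (atom U vx vx))
      U-inhabited = pure (const (elem M) , subst₂ Uᴾ (sym (update-≡ σ vx _)) (sym (update-≡ σ vx _)) (Uᴾ-const _))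

      perI-holds : ∀ i → All (Sat Mᵏ σ) (perI i)
      perI-holds i = E1-def ∷ Ek-def ∷ Q-def ∷ π-functional ∷ π-total ∷ Q-reaches ∷ []
        where
        E1-def : Sat Mᵏ σ (all vx (all vy (iff (atom (E1 i) vx vy) (and (E1prev i vx vy) (commonπ i)))))
        E1-def = all-intro λ d → pure (all-intro λ e → pure
          ( imp-intro (λ r → let (prev , d≈e) = E1-unfold i d e (atom-xy⁻ (E1 i) r) in
              pure (sat-E1prev⁺ i prev , sat-commonπ⁺ i (Agree⇒Commonπ i d e d≈e)))
          , imp-intro (λ (prev , c) → do
              c′ ← sat-commonπ⁻ i c
              pure (atom-xy⁺ (E1 i) (E1-fold i d e (sat-E1prev⁻ i prev) (Commonπ⇒Agree i d e c′))))))

        Ek-def : Sat Mᵏ σ (all vx (all vy (iff (atom (Ek i) vx vy) (and (EkNext i vx vy) (commonπ i)))))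
        Ek-def = all-intro λ d → pure (all-intro λ e → pure
          ( imp-intro (λ r → let (next , d≈e) = Ek-unfold i d e (atom-xy⁻ (Ek i) r) in
              pure (sat-EkNext⁺ i next , sat-commonπ⁺ i (Agree⇒Commonπ i d e d≈e)))
          , imp-intro (λ (next , c) → do
              c′ ← sat-commonπ⁻ i c
              pure (atom-xy⁺ (Ek i) (Ek-fold i d e (sat-EkNext⁻ i next) (Commonπ⇒Agree i d e c′))))))

        Q-def : Sat Mᵏ σ (all vx (all vy (iff (atom (Q i) vx vy) (and (E1prev i vx vy) (EkNext i vx vy)))))
        Q-def = all-intro λ d → pure (all-intro λ e → pure
          ( imp-intro (λ q → let (prev , next) = Q-unfold i d e (atom-xy⁻ (Q i) q) in
              pure (sat-E1prev⁺ i prev , sat-EkNext⁺ i next))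
          , imp-intro (λ (prev , next) →
              pure (atom-xy⁺ (Q i) (Q-fold i d e (sat-E1prev⁻ i prev) (sat-EkNext⁻ i next))))))

        π-functional : Sat Mᵏ σ (all vx (all vy (all vz (imp (and (atom (π i) vx vy) (atom (π i) vx vz)) (eq vy vz)))))
        π-functional = all-intro λ _ → pure (all-intro λ _ → pure (all-intro λ _ → pure (imp-intro λ (p , q) →
          pure (trans p (sym q)))))

        π-total : Sat Mᵏ σ (all vx (ex vy (and (atom (π i) vx vy) (atom U vy vy))))
        π-total = all-intro λ d → pure (pure (const (lookup d i)
          , atom-xy⁺ (π i) refl
          , subst₂ Uᴾ (sym (upd₂-y d _)) (sym (upd₂-y d _)) (Uᴾ-const _)))

        Q-reaches : Sat Mᵏ σ (all vx (all vy (imp (atom U vy vy) (ex vz (and (atom (Q i) vx vz) (atom (π i) vz vy))))))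
        Q-reaches = all-intro λ d → pure (all-intro λ e → pure (imp-intro λ u →
          let f = d [ i ]≔ lookup e i in pure (pure (f
          , subst₂ (relᴾ (Q i)) (sym (upd₃-x d e f)) (sym (upd₃-z d e f))
              (λ j j≢i → sym (lookup∘update′ j≢i d (lookup e i)))
          , subst₂ (relᴾ (π i)) (sym (upd₃-z d e f)) (sym (upd₃-y d e f))
              (trans (subst₂ Uᴾ (upd₂-y d e) (upd₂-y d e) u i) (cong const (sym (lookup∘update i d (lookup e i)))))))))

      perA-holds : ∀ a → Sat Mᵏ σ (perA a)
      perA-holds a = all-intro λ _ → pure (all-intro λ _ → pure (imp-intro λ (ux , uy , _) → pure (ux , uy)))

      Γ-holds : ∀ {W} (φ : Formula ℕ W) → Sat Mᵏ σ (bigAnd vx (Γ φ))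
      Γ-holds φ = sat-bigAnd⁺ Mᵏ vx (Γ φ) (U-def ∷ U⇒eq ∷ eq⇔E1k ∷ U-inhabited ∷
        All.++⁺ (All.concat⁺ (All.map⁺ (All-allFin⁺ K perI-holds))) (All.map⁺ (universal perA-holds (syms φ))))

  module _ (xs : Fin K → ℕ) (xs-inj : Injective _≡_ _≡_ xs) where

    Lists : V → (ℕ → D) → Set
    Lists v ρ = ∀ i → ρ (xs i) ≡ lookup v i

    Lists-update : ∀ {ρ i c} v e → Lists v ρ → (∀ j → j ≢ i → Agree j v e) → lookup e i ≡ c →
                   Lists e (update ρ (xs i) c)
    Lists-update {ρ} {i} {c} v e vρ v≈e eᵢ≡c j with i ≟ᶠ j
    ... | yes refl = trans (update-≡ ρ (xs i) c) (sym eᵢ≡c)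
    ... | no i≢j   = trans (update-≢ ρ c (i≢j ∘ xs-inj)) (trans (vρ j) (v≈e j (≢-sym i≢j)))

    atom-forth : ∀ v ρ a i j e′ e″ → Lists v ρ → relᴾ (π i) v e′ → relᴾ (base a) e′ e″ → relᴾ (π j) v e″ →
                 ¬ ¬ rel M a (ρ (xs i)) (ρ (xs j))
    atom-forth v ρ a i j e′ e″ vρ p (_ , _ , r) q = pure
      (subst₂ (rel M a) (trans (cong (λ u → lookup u zero) p) (sym (vρ i)))
                        (trans (cong (λ u → lookup u zero) q) (sym (vρ j))) r)

    atom-back : ∀ v ρ a i j → Lists v ρ → rel M a (ρ (xs i)) (ρ (xs j)) →
                ¬ ¬ (Σ[ e′ ∈ V ] Σ[ e″ ∈ V ] relᴾ (π i) v e′ × relᴾ (base a) e′ e″ × relᴾ (π j) v e″)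
    atom-back v ρ a i j vρ r = pure
      (const (lookup v i) , const (lookup v j) , refl
      , (Uᴾ-const _ , Uᴾ-const _ , subst₂ (rel M a) (vρ i) (vρ j) r) , refl)

    ex-forth : ∀ v ρ i e → Lists v ρ → relᴾ (Q i) v e → ¬ ¬ (Σ[ c ∈ D ] Lists e (update ρ (xs i) c))
    ex-forth v ρ i e vρ q = pure (_ , Lists-update v e vρ q refl)

    ex-back : ∀ v ρ i → Lists v ρ → (c : D) → ¬ ¬ (Σ[ e ∈ V ] relᴾ (Q i) v e × Lists e (update ρ (xs i) c))
    ex-back v ρ i vρ c = pure (v [ i ]≔ c , v≈e , Lists-update v (v [ i ]≔ c) vρ v≈e (lookup∘update i v c))
      where
      v≈e : ∀ j → j ≢ i → Agree j v (v [ i ]≔ c)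
      v≈e j j≢i = sym (lookup∘update′ j≢i v c)

    module _ (w : Fin 3 → ℕ) (w-inj : Injective _≡_ _≡_ w) where
      open Translation Mᵏ M xs w w-inj Lists atom-forth atom-back ex-forth ex-back public

  Mᵏ-valid⇒¬¬sat : (vx vy vz : ℕ) (x≢y : vx ≢ vy) (x≢z : vx ≢ vz) (y≢z : vy ≢ vz)
    (xs : Fin K → ℕ) → Injective _≡_ _≡_ xs → (w : Fin 3 → ℕ) → Injective _≡_ _≡_ w →
    ∀ {φ} → EqFree φ → ∀ z → (∀ σ → Sat Mᵏ σ (imp (bigAnd vx (Gamma.Γ K vx vy vz φ)) (T K w z φ))) →
    ∀ ρ → ¬ ¬ Sat M ρ (rename xs φ)
  Mᵏ-valid⇒¬¬sat vx vy vz x≢y x≢z y≢z xs xs-inj w w-inj {φ} ef z valid ρ = do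
    t ← imp-elim (valid σ) (Γ-holds vx vy vz x≢y x≢z y≢z σ φ)
    proj₁ (sat-T xs xs-inj w w-inj ef z (λ i → sym (lookup∘tabulate (ρ ∘ xs) i))) t
    where
    σ : ℕ → V
    σ _ = tabulate (ρ ∘ xs)

module GammaModel {n : ℕ} (N : Structure (Sym (suc n))) (vx vy vz : ℕ)
  (x≢y : vx ≢ vy) (x≢z : vx ≢ vz) (y≢z : vy ≢ vz)
  (σ₀ : ℕ → Carrier N) {W : Set} (φ : Formula ℕ W) (γ : Sat N σ₀ (bigAnd vx (Gamma.Γ (suc n) vx vy vz φ))) where

  private
    K = suc n
    B = Carrier N
    R = rel N

  open Gamma K vx vy vz
  open GammaSemantics N vx vy vz x≢y x≢z y≢z

  record IndexAxioms (i : Fin K) : Set where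
    field
      E1-unfold    : ∀ d e → R (E1 i) d e → ¬ ¬ (E1prevᴿ i d e × Commonπᴿ i d e)
      Ek-unfold    : ∀ d e → R (Ek i) d e → ¬ ¬ (EkNextᴿ i d e × Commonπᴿ i d e)
      Q-unfold     : ∀ d e → R (Q i) d e → ¬ ¬ (E1prevᴿ i d e × EkNextᴿ i d e)
      π-functional : ∀ d y y′ → R (π i) d y → R (π i) d y′ → ¬ ¬ y ≡ y′
      π-total      : ∀ d → ¬ ¬ (Σ[ y ∈ B ] R (π i) d y × R U y y)
      Q-reaches    : ∀ d y → R U y y → ¬ ¬ (Σ[ e ∈ B ] R (Q i) d e × R (π i) e y)

  perI-sat : ∀ i → All (Sat N σ₀) (perI i)
  perI-sat i with sat-bigAnd⁻ N vx (Γ φ) γ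
  ... | _ ∷ _ ∷ _ ∷ _ ∷ rest =
    All-allFin⁻ K (All.map⁻ {f = perI} (All.concat⁻ {xss = map perI (allFin K)}
      (All.++⁻ˡ (concatMap perI (allFin K)) rest))) i

  index-axioms : ∀ i → IndexAxioms i
  index-axioms i with perI-sat i
  ... | E1-def ∷ Ek-def ∷ Q-def ∷ π-fun ∷ π-tot ∷ Q-reach ∷ [] = record
    { E1-unfold = λ d e r → do
        s ← all-elim E1-def d
        t ← all-elim s e
        (prev , c) ← imp-elim (proj₁ t) (atom-xy⁺ (E1 i) r)
        c′ ← sat-commonπ⁻ i c
        pure (sat-E1prev⁻ i prev , c′)
    ; Ek-unfold = λ d e r → do
        s ← all-elim Ek-def d
        t ← all-elim s e
        (next , c) ← imp-elim (proj₁ t) (atom-xy⁺ (Ek i) r)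
        c′ ← sat-commonπ⁻ i c
        pure (sat-EkNext⁻ i next , c′)
    ; Q-unfold = λ d e q → do
        s ← all-elim Q-def d
        t ← all-elim s e
        (prev , next) ← imp-elim (proj₁ t) (atom-xy⁺ (Q i) q)
        pure (sat-E1prev⁻ i prev , sat-EkNext⁻ i next)
    ; π-functional = λ d y y′ p p′ → do
        s ← all-elim π-fun d
        t ← all-elim s y
        u ← all-elim t y′
        y≡y′ ← imp-elim u ( subst₂ (R (π i)) (sym (upd₃-x d y y′)) (sym (upd₃-y d y y′)) p
                           , subst₂ (R (π i)) (sym (upd₃-x d y y′)) (sym (upd₃-z d y y′)) p′)
        pure (trans (sym (upd₃-y d y y′)) (trans y≡y′ (upd₃-z d y y′)))
    ; π-total = λ d → do
        s ← all-elim π-tot d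
        (y , p , u) ← s
        pure (y , atom-xy⁻ (π i) p , subst₂ (R U) (upd₂-y d y) (upd₂-y d y) u)
    ; Q-reaches = λ d y u → do
        s ← all-elim Q-reach d
        t ← all-elim s y
        r ← imp-elim t (subst₂ (R U) (sym (upd₂-y d y)) (sym (upd₂-y d y)) u)
        (e , q , p) ← r
        pure (e , subst₂ (R (Q i)) (upd₃-x d y e) (upd₃-z d y e) q
                , subst₂ (R (π i)) (upd₃-z d y e) (upd₃-y d y e) p)
    }

  open module Axioms (i : Fin K) = IndexAxioms (index-axioms i) public

  -- The index is tracked through its value m: E1prev steps from suc i to inject₁ i,
  -- which is not structurally smaller.
  E1⇒Commonπ : ∀ m {i} → toℕ i ≡ m → ∀ {d e} → R (E1 i) d e → ∀ j → toℕ j ≤ m → ¬ ¬ Commonπᴿ j d e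
  E1⇒Commonπ m {i} i≡m {d} {e} r j j≤m with m≤n⇒m<n∨m≡n j≤m
  ... | inj₂ j≡m = do
    (_ , c) ← E1-unfold i d e r
    pure (subst (λ j → Commonπᴿ j d e) (toℕ-injective (trans i≡m (sym j≡m))) c)
  E1⇒Commonπ (suc m) {suc i} i≡m {d} {e} r j _ | inj₁ j<m = do
    (prev , _) ← E1-unfold (suc i) d e r
    E1⇒Commonπ m (trans (toℕ-inject₁ i) (suc-injective i≡m)) prev j (≤-pred j<m)

  Ek⇒Commonπ : ∀ m {i} → m + toℕ i ≡ K → ∀ {d e} → R (Ek i) d e → ∀ j → toℕ i ≤ toℕ j → ¬ ¬ Commonπᴿ j d e
  Ek⇒Commonπ m {i} m+i≡K {d} {e} r j i≤j with m≤n⇒m<n∨m≡n i≤j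
  ... | inj₂ i≡j = do
    (_ , c) ← Ek-unfold i d e r
    pure (subst (λ j → Commonπᴿ j d e) (toℕ-injective i≡j) c)
  Ek⇒Commonπ zero    {i} i≡K _ _ _ | inj₁ _ = ⊥-elim (<⇒≢ (toℕ<n i) i≡K)
  Ek⇒Commonπ (suc m) {i} m+i≡K {d} {e} r j _ | inj₁ i<j = do
    (next , _) ← Ek-unfold i d e r
    Ek⇒Commonπ m (trans (cong (m +_) (toℕ-fromℕ< p)) (trans (+-suc m (toℕ i)) m+i≡K)) (next p) j
      (subst (_≤ toℕ j) (sym (toℕ-fromℕ< p)) i<j)
    where p = ≤-<-trans i<j (toℕ<n j)

  Q⇒Commonπ : ∀ i {d e} → R (Q i) d e → ∀ j → j ≢ i → ¬ ¬ Commonπᴿ j d e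
  Q⇒Commonπ i {d} {e} q j j≢i = do
    (prev , next) ← Q-unfold i d e q
    by-position i j≢i prev next (<-cmp (toℕ j) (toℕ i))
    where
    by-position : ∀ i → j ≢ i → E1prevᴿ i d e → EkNextᴿ i d e →
                  Tri (toℕ j < toℕ i) (toℕ j ≡ toℕ i) (toℕ i < toℕ j) → ¬ ¬ Commonπᴿ j d e
    by-position (suc i) _ prev _ (tri< j<i _ _) =
      E1⇒Commonπ _ refl prev j (subst (toℕ j ≤_) (sym (toℕ-inject₁ i)) (≤-pred j<i))
    by-position i j≢i _ _ (tri≈ _ j≡i _) = ⊥-elim (j≢i (toℕ-injective j≡i))
    by-position i _ _ next (tri> _ _ i<j) =
      Ek⇒Commonπ (K ∸ toℕ (fromℕ< p)) (m∸n+n≡m (<⇒≤ (toℕ<n (fromℕ< p)))) (next p) j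
        (subst (_≤ toℕ j) (sym (toℕ-fromℕ< p)) i<j)
      where p = ≤-<-trans i<j (toℕ<n j)

  module Points (C : Set) (c₀ : C) (emb : C → B) (emb-U : ∀ c → R U (emb c) (emb c))
    (emb-onto : ∀ y → R U y y → ¬ ¬ (Σ[ c ∈ C ] emb c ≡ y)) where

    Mᵁ : Structure ℕ
    Mᵁ = record { Carrier = C ; elem = c₀ ; rel = λ a c c′ → R (base a) (emb c) (emb c′) }

    π-point : ∀ i d → ¬ ¬ (Σ[ c ∈ C ] R (π i) d (emb c))
    π-point i d = do
      (y , p , u) ← π-total i d
      (c , c≡y) ← emb-onto y u
      pure (c , subst (R (π i) d) (sym c≡y) p)

    module _ (xs : Fin K → ℕ) (xs-inj : Injective _≡_ _≡_ xs) where

      Projects : B → (ℕ → C) → Set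
      Projects v ρ = ∀ i → ¬ ¬ R (π i) v (emb (ρ (xs i)))

      Projects-update : ∀ v e ρ i c → Projects v ρ → R (Q i) v e → R (π i) e (emb c) →
                        Projects e (update ρ (xs i) c)
      Projects-update v e ρ i c vρ q p j with i ≟ᶠ j
      ... | yes refl = pure (subst (R (π i) e ∘ emb) (sym (update-≡ ρ (xs i) c)) p)
      ... | no i≢j = do
        (y , vy , ey) ← Q⇒Commonπ i q j (≢-sym i≢j)
        vρ′ ← vρ j
        y≡ρ ← π-functional j v y _ vy vρ′
        pure (subst (R (π j) e) (trans y≡ρ (cong emb (sym (update-≢ ρ c (i≢j ∘ xs-inj))))) ey)

      atom-forth : ∀ v ρ a i j e′ e″ → Projects v ρ → R (π i) v e′ → R (base a) e′ e″ → R (π j) v e″ →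
                   ¬ ¬ R (base a) (emb (ρ (xs i))) (emb (ρ (xs j)))
      atom-forth v ρ a i j e′ e″ vρ p r q = do
        pᵢ ← vρ i
        pⱼ ← vρ j
        e′≡ ← π-functional i v e′ _ p pᵢ
        e″≡ ← π-functional j v e″ _ q pⱼ
        pure (subst₂ (R (base a)) e′≡ e″≡ r)

      atom-back : ∀ v ρ a i j → Projects v ρ → R (base a) (emb (ρ (xs i))) (emb (ρ (xs j))) →
                  ¬ ¬ (Σ[ e′ ∈ B ] Σ[ e″ ∈ B ] R (π i) v e′ × R (base a) e′ e″ × R (π j) v e″)
      atom-back v ρ a i j vρ r = do
        pᵢ ← vρ i
        pⱼ ← vρ j
        pure (_ , _ , pᵢ , r , pⱼ)

      ex-forth : ∀ v ρ i e → Projects v ρ → R (Q i) v e → ¬ ¬ (Σ[ c ∈ C ] Projects e (update ρ (xs i) c))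
      ex-forth v ρ i e vρ q = do
        (c , p) ← π-point i e
        pure (c , Projects-update v e ρ i c vρ q p)

      ex-back : ∀ v ρ i → Projects v ρ → (c : C) → ¬ ¬ (Σ[ e ∈ B ] R (Q i) v e × Projects e (update ρ (xs i) c))
      ex-back v ρ i vρ c = do
        (e , q , p) ← Q-reaches i v (emb c) (emb-U c)
        pure (e , q , Projects-update v e ρ i c vρ q p)

      module _ (w : Fin 3 → ℕ) (w-inj : Injective _≡_ _≡_ w) where
        open Translation N Mᵁ xs w w-inj Projects atom-forth atom-back ex-forth ex-back public

        Mᵁ-valid⇒¬¬sat : ∀ {ψ} → EqFree ψ → (∀ ρ → Sat Mᵁ ρ (rename xs ψ)) → ∀ z σ → ¬ ¬ Sat N σ (T K w z ψ)
        Mᵁ-valid⇒¬¬sat ef valid z σ = do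
          -- choosing a U-point under each π_i(σ z) is harmless under ¬¬, as there are finitely many i
          c ← ¬¬-Π-Fin K (λ i → π-point i (σ (w z)))
          let ρ = extend xs (proj₁ ∘ c) c₀
          proj₂ (sat-T ef z λ i →
                  pure (subst (R (π i) (σ (w z)) ∘ emb) (sym (extend-xs xs xs-inj _ c₀ i)) (proj₂ (c i))))
                (valid ρ)

module Reduction {n : ℕ} (xs : Fin (suc n) → ℕ) (xs-inj : Injective _≡_ _≡_ xs)
  (w : Fin 3 → ℕ) (w-inj : Injective _≡_ _≡_ w)
  {φ : Formula ℕ (Fin (suc n))} (ef : EqFree φ)
  (vx vy vz : ℕ) (x≢y : vx ≢ vy) (x≢z : vx ≢ vz) (y≢z : vy ≢ vz) (z : Fin 3) where

  private
    K = suc n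
    reduct = imp (bigAnd vx (Gamma.Γ K vx vy vz φ)) (T K w z φ)

  ¬¬-from-power : ∀ M → (∀ σ → Sat (Power.Mᵏ M n) σ reduct) → ∀ ρ → ¬ ¬ Sat M ρ (rename xs φ)
  ¬¬-from-power M = Power.Mᵏ-valid⇒¬¬sat M n vx vy vz x≢y x≢z y≢z xs xs-inj w w-inj ef z

  reduct-valid⇒valid : Valid reduct → Valid (rename xs φ)
  reduct-valid⇒valid valid M ρ =
    valid-from-¬¬ (rename-EqFree xs ef) (λ _ → ⊤) tt (λ M _ → ¬¬-from-power M (valid (Power.Mᵏ M n))) M tt ρ

  reduct-finitelyValid⇒finitelyValid : FinitelyValid reduct → FinitelyValid (rename xs φ)
  reduct-finitelyValid⇒finitelyValid valid =
    valid-from-¬¬ (rename-EqFree xs ef) FiniteStructure (trivial-finite {ℕ})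
      (λ M (m , iso) → ¬¬-from-power M (valid (Power.Mᵏ M n) (m ^ K , Vec↔Fin^ iso K)))

  valid⇒reduct-valid : Valid (rename xs φ) → Valid reduct
  valid⇒reduct-valid valid N σ (γ , ¬t) = π-total zero (σ vx) λ (y₀ , _ , u₀) →
    Points.Mᵁ-valid⇒¬¬sat (Σ _ λ y → rel N U y y) (y₀ , u₀) proj₁ proj₂ (λ y u → pure ((y , u) , refl))
      xs xs-inj w w-inj ef (valid _) z σ ¬t
    where open GammaModel N vx vy vz x≢y x≢z y≢z σ φ γ

  -- In a finite N, U is classically decidable, so N itself, retracted onto its U-points,
  -- is a finite universe for φ.
  finitelyValid⇒reduct-finitelyValid : FinitelyValid (rename xs φ) → FinitelyValid reduct
  finitelyValid⇒reduct-finitelyValid valid N (m , iso) σ (γ , ¬t) =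
    π-total zero (σ vx) λ (y₀ , _ , u₀) → ¬¬-Dec-finite iso λ U? →
      Points.Mᵁ-valid⇒¬¬sat (Carrier N) y₀ (retract U? y₀ u₀) (λ y → retract-∈ U? y₀ u₀ y)
        (λ y u → pure (y , retract-id U? y₀ u₀ u)) xs xs-inj w w-inj ef (λ ρ → valid _ (m , iso) ρ) z σ ¬t
    where open GammaModel N vx vy vz x≢y x≢z y≢z σ φ γ

lemma7 : (k : ℕ) (h : 3 ≤ k) (xs : Fin k → ℕ) → Injective _≡_ _≡_ xs →
         (φ : Formula ℕ (Fin k)) → EqFree φ →
         (vx vy vz : ℕ) → vx ≢ vy → vx ≢ vz → vy ≢ vz →
         (z : Fin 3) →
         (Valid (imp (bigAnd vx (Gamma.Γ k vx vy vz φ)) (T k (λ j → xs (inject≤ j h)) z φ))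
            ⇔ Valid (rename xs φ))
         × (FinitelyValid (imp (bigAnd vx (Gamma.Γ k vx vy vz φ)) (T k (λ j → xs (inject≤ j h)) z φ))
            ⇔ FinitelyValid (rename xs φ))
lemma7 (suc n) h xs xs-inj φ ef vx vy vz x≢y x≢z y≢z z =
    mk⇔ reduct-valid⇒valid valid⇒reduct-valid
  , mk⇔ reduct-finitelyValid⇒finitelyValid finitelyValid⇒reduct-finitelyValid
  where
  open Reduction xs xs-inj (λ j → xs (inject≤ j h)) (inject≤-injective h h _ _ ∘ xs-inj) ef vx vy vz x≢y x≢z y≢z z
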